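{- Let $K\subseteq L$ be real closed fields and $C$ a positive Dedekind cut in $L$ which is not additive. Let $C'$ and $C'_{\mathrm{add}}$ be the cuts induced on $K$ by $C$ and by $C_{\mathrm{add}}$ respectively (where $C_{\mathrm{add}}$ is computed in $L$). Suppose that $C'_{\mathrm{add}}=(C')_{\mathrm{add}}$ (the latter computed in $K$), and that $x,y\in L$ are two realizations of the cut $C'$ with $x\in C^-$ and $y\in C^+$. Then $y-x$ induces the cut $C'_{\mathrm{add}}$ on $K$.
   Context: For an ordered field $F$, a cut is a pair $D=(D^-,D^+)$ with $F=D^-\cup D^+$ disjoint and $D^-<D^+$; it is Dedekind if both sides are nonempty, $D^-$ has no maximum and $D^+$ no minimum; it is positive if $D^-$ contains a positive element; it is additive if $D^-$ is closed under addition and contains a positive element. If $K\subseteq L$ and $D$ is a cut of $L$, the cut induced on $K$ is $(D^-\cap K,D^+\cap K)$; an element $a\in L$ induces on $K$ the cut $(\{c\in K:c<a\},\{c\in K:c\ge a\})$ and realizes a cut $E$ of $K$ if $E^-<a<E^+$. $D_{\mathrm{add}}$ is the cut of $F$ with left side $\{r\in F: r+D^-\subseteq D^-\}$. -}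

module Defs where

open import Level using (0ℓ)
open import Data.Nat using (ℕ; zero; suc) renaming (_+_ to _+ℕ_)
open import Data.Fin using (Fin) renaming (zero to fzero; suc to fsuc)
open import Data.Sum using (_⊎_)
open import Data.Product using (Σ; ∃; _×_; _,_)
open import Data.Empty using (⊥)
open import Relation.Nullary using (¬_)
open import Relation.Unary using (Pred)
open import Relation.Binary.PropositionalEquality using (_≡_; _≢_)
open import Relation.Binary.Structures using (IsStrictTotalOrder)
open import Algebra.Structures using (IsCommutativeRing)
open import Function.Bundles using (_⇔_)

record OrderedField : Set₁ where
  infixl 6 _+_ _-_
  infixl 7 _*_
  infix 4 _<_ _≤_
  field
    Carrier : Set
    _+_ _*_ : Carrier → Carrier → Carrier
    -_      : Carrier → Carrier
    0# 1#   : Carrier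
    _<_     : Carrier → Carrier → Set
    isCommutativeRing : IsCommutativeRing _≡_ _+_ _*_ -_ 0# 1#
    0≢1     : 0# ≢ 1#
    inverse : ∀ x → x ≢ 0# → ∃ λ y → x * y ≡ 1#
    isStrictTotalOrder : IsStrictTotalOrder _≡_ _<_
    +-mono-< : ∀ a b c → a < b → a + c < b + c
    *-pos    : ∀ a b → 0# < a → 0# < b → 0# < a * b

  _-_ : Carrier → Carrier → Carrier
  a - b = a + (- b)

  _≤_ : Carrier → Carrier → Set
  a ≤ b = a < b ⊎ a ≡ b

  _^_ : Carrier → ℕ → Carrier
  x ^ zero  = 1#
  x ^ suc n = x * (x ^ n)

  evalCoeffs : (n : ℕ) → (Fin n → Carrier) → Carrier → Carrier
  evalCoeffs zero    c x = 0#
  evalCoeffs (suc n) c x = c fzero + x * evalCoeffs n (λ i → c (fsuc i)) x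

  evalMonic : (d : ℕ) → (Fin d → Carrier) → Carrier → Carrier
  evalMonic d c x = (x ^ d) + evalCoeffs d c x

  odd : ℕ → ℕ
  odd n = suc (n +ℕ n)

record RealClosedField : Set₁ where
  field
    orderedField : OrderedField
  open OrderedField orderedField public
  field
    sqrt     : ∀ a → 0# ≤ a → ∃ λ b → b * b ≡ a
    oddRoot  : ∀ n (c : Fin (odd n) → Carrier) → ∃ λ x → evalMonic (odd n) c x ≡ 0#

module _ (L : RealClosedField) where
  open RealClosedField L

  record IsRealClosedSubfield (K : Pred Carrier 0ℓ) : Set where
    field
      0∈ : K 0#
      1∈ : K 1#
      +∈ : ∀ {a b} → K a → K b → K (a + b)
      *∈ : ∀ {a b} → K a → K b → K (a * b)
      -∈ : ∀ {a} → K a → K (- a)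
      inv∈ : ∀ {a b} → K a → a * b ≡ 1# → K b
      sqrt∈ : ∀ a → K a → 0# ≤ a → Σ Carrier λ b → K b × b * b ≡ a
      oddRoot∈ : ∀ n (c : Fin (odd n) → Carrier) → (∀ i → K (c i)) →
                 Σ Carrier λ x → K x × evalMonic (odd n) c x ≡ 0#

  -- Cuts.  A cut D = (D⁻, D⁺) of L is represented by its left side D⁻ as
  -- a predicate; D⁺ is the complement ¬ D⁻.  D⁻ < D⁺ is required.

  IsCut : Pred Carrier 0ℓ → Set
  IsCut D = ∀ a b → D a → ¬ D b → a < b

  IsDedekind : Pred Carrier 0ℓ → Set
  IsDedekind D =
    (∃ λ a → D a) × (∃ λ b → ¬ D b) ×
    (∀ a → D a → ∃ λ a' → D a' × a < a') ×
    (∀ b → ¬ D b → ∃ λ b' → ¬ D b' × b' < b)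

  IsPositive : Pred Carrier 0ℓ → Set
  IsPositive D = ∃ λ a → D a × 0# < a

  IsAdditive : Pred Carrier 0ℓ → Set
  IsAdditive D = (∀ a b → D a → D b → D (a + b)) × IsPositive D

  -- left side of D_add computed in L:  { r ∈ L : r + D⁻ ⊆ D⁻ }
  AddL : Pred Carrier 0ℓ → Pred Carrier 0ℓ
  AddL D r = ∀ d → D d → D (r + d)

  -- left side of (C')_add computed in K, where C' is the cut induced on K
  -- by D (its left side is D⁻ ∩ K):  { r ∈ K : r + (D⁻ ∩ K) ⊆ D⁻ ∩ K }
  AddK : Pred Carrier 0ℓ → Pred Carrier 0ℓ → Pred Carrier 0ℓ
  AddK K D r = K r × (∀ d → K d → D d → D (r + d))

  RealizesOn : Pred Carrier 0ℓ → Pred Carrier 0ℓ → Carrier → Set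
  RealizesOn K D a = ∀ c → K c → (D c → c < a) × (¬ D c → a < c)

  InducesOn : Pred Carrier 0ℓ → Carrier → Pred Carrier 0ℓ → Set
  InducesOn K a E = ∀ c → K c → (c < a ⇔ E c)

-- If r ∈ K lies below y − x then r + d < y for every d ∈ C' (as d < x), and since y realizes C'
-- this puts r + d into C; so r ∈ (C')_add = C'_add.  Conversely r ∈ C_add gives r + x ∈ C⁻ < y.
module Submission where

open import Defs
open import Level using (0ℓ)
open import Data.Product using (_,_; proj₁; proj₂)
open import Relation.Nullary using (¬_)
open import Relation.Nullary.Decidable using (decidable-stable)
open import Relation.Unary using (Pred)
open import Function.Bundles using (_⇔_; mk⇔; Equivalence)
open import Axiom.ExcludedMiddle using (ExcludedMiddle)
open import Relation.Binary.PropositionalEquality using (_≡_; cong; subst; subst₂; module ≡-Reasoning)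
open import Algebra.Structures using (IsCommutativeRing)
open import Relation.Binary.Structures using (IsStrictTotalOrder)

module OrderedFieldProperties (F : OrderedField) where
  open OrderedField F
  open IsCommutativeRing isCommutativeRing using (+-assoc; +-comm; -‿inverseˡ; -‿inverseʳ; +-identityʳ)
  open IsStrictTotalOrder isStrictTotalOrder using () renaming (trans to <-trans)
  open ≡-Reasoning

  m-n+n≡m : ∀ m n → (m - n) + n ≡ m
  m-n+n≡m m n = begin
    (m - n) + n    ≡⟨ +-assoc m (- n) n ⟩
    m + (- n + n)  ≡⟨ cong (m +_) (-‿inverseˡ n) ⟩
    m + 0#         ≡⟨ +-identityʳ m ⟩
    m              ∎

  m+n-n≡m : ∀ m n → (m + n) - n ≡ m
  m+n-n≡m m n = begin
    (m + n) - n    ≡⟨ +-assoc m n (- n) ⟩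
    m + (n - n)    ≡⟨ cong (m +_) (-‿inverseʳ n) ⟩
    m + 0#         ≡⟨ +-identityʳ m ⟩
    m              ∎

  +-monoʳ-< : ∀ m {n o} → n < o → m + n < m + o
  +-monoʳ-< m {n} {o} n<o = subst₂ _<_ (+-comm n m) (+-comm o m) (+-mono-< n o m n<o)

  m+n<o⇒m<o-n : ∀ {m n o} → m + n < o → m < o - n
  m+n<o⇒m<o-n {m} {n} {o} m+n<o = subst (_< o - n) (m+n-n≡m m n) (+-mono-< (m + n) o (- n) m+n<o)

  m<o-n⇒m+n<o : ∀ {m n o} → m < o - n → m + n < o
  m<o-n⇒m+n<o {m} {n} {o} m<o-n = subst (m + n <_) (m-n+n≡m o n) (+-mono-< m (o - n) n m<o-n)

  +-mono-<-< : ∀ {m n o p} → m < n - o → p < o → m + p < n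
  +-mono-<-< {m} m<n-o p<o = <-trans (+-monoʳ-< m p<o) (m<o-n⇒m+n<o m<n-o)

module CutProperties (L : RealClosedField) where
  open RealClosedField L
  open OrderedFieldProperties orderedField
  open IsStrictTotalOrder isStrictTotalOrder using (asym)

  module _ {C : Pred Carrier 0ℓ} {x y : Carrier} where

    AddL⇒<-gap : IsCut L C → C x → ¬ C y → ∀ {r} → AddL L C r → r < y - x
    AddL⇒<-gap cut x∈C y∉C r∈Add = m+n<o⇒m<o-n (cut _ y (r∈Add x x∈C) y∉C)

    -- The excluded middle is needed because membership in C is not decidable.
    <-realizer⇒∈ : ExcludedMiddle 0ℓ → {K : Pred Carrier 0ℓ} → RealizesOn L K C y →
                   ∀ {c} → K c → c < y → C c
    <-realizer⇒∈ em y-realizes c∈K c<y =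
      decidable-stable em λ c∉C → asym c<y (proj₂ (y-realizes _ c∈K) c∉C)

    <-gap⇒AddK : ExcludedMiddle 0ℓ → {K : Pred Carrier 0ℓ} →
                 (∀ {a b} → K a → K b → K (a + b)) →
                 RealizesOn L K C x → RealizesOn L K C y →
                 ∀ {r} → K r → r < y - x → AddK L K C r
    <-gap⇒AddK em +∈ x-realizes y-realizes r∈K r<y-x = r∈K , λ d d∈K d∈C →
      <-realizer⇒∈ em y-realizes (+∈ r∈K d∈K)
        (+-mono-<-< r<y-x (proj₁ (x-realizes d d∈K) d∈C))

lemma2p11 : ExcludedMiddle 0ℓ →
    (L : RealClosedField) → (K : Pred (RealClosedField.Carrier L) 0ℓ) →
    IsRealClosedSubfield L K →
    (C : Pred (RealClosedField.Carrier L) 0ℓ) →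
    IsCut L C → IsDedekind L C → IsPositive L C → ¬ IsAdditive L C →
    (∀ r → K r → (AddL L C r ⇔ AddK L K C r)) →
    (x y : RealClosedField.Carrier L) →
    RealizesOn L K C x → RealizesOn L K C y → C x → ¬ C y →
    InducesOn L K (RealClosedField._-_ L y x) (AddL L C)
lemma2p11 em L K K-subfield C cut _ _ _ AddL⇔AddK x y x-realizes y-realizes x∈C y∉C r r∈K =
  mk⇔ (λ r<y-x → Equivalence.from (AddL⇔AddK r r∈K)
                   (<-gap⇒AddK em +∈ x-realizes y-realizes r∈K r<y-x))
      (AddL⇒<-gap cut x∈C y∉C)
  where
  open CutProperties L
  open IsRealClosedSubfield K-subfield using (+∈)
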